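{- Let $(\Phi,\leq,D;\otimes,d,\downarrow,e)$ be an ordered valuation algebra and define $\varphi\leq'\psi$ iff $d(\varphi)\leq d(\psi)$ and $\varphi\otimes e_{d(\psi)}\leq\psi$. Then $(\Phi,\leq',D;\otimes,d,\downarrow,e)$ satisfies all the conditions of an ordered valuation algebra except that $\varphi\leq'\psi$ need not imply $d(\varphi)=d(\psi)$; here the condition that focusing preserves ordering is taken in the form: if $\varphi\leq'\psi$ and $x\leq d(\varphi)$ then $\varphi^{\downarrow x}\leq'\psi^{\downarrow x}$.
   Context: A (stable) ordered valuation algebra $(\Phi,\leq,D;\otimes,d,\downarrow,e)$ consists of a partially ordered set $(\Phi,\leq)$, a bounded lattice $D$, a total operation $\otimes\colon\Phi\times\Phi\to\Phi$, a map $d\colon\Phi\to D$, a partial operation $(\varphi,x)\mapsto\varphi^{\downarrow x}$ defined when $x\leq d(\varphi)$, and a map $e\colon D\to\Phi$, $x\mapsto e_x$, such that, with $\Phi_x=\{\varphi: d(\varphi)=x\}$: (1) $(\Phi,\otimes)$ is a commutative semigroup; (2) $\varphi\leq\psi$ implies $d(\varphi)=d(\psi)$; (3) $d(e_x)=x$, $e_x\otimes e_y=e_{x\vee y}$, and $\varphi\otimes e_x=\varphi$ for $\varphi\in\Phi_x$; (4) $e_y^{\downarrow x}=e_x$ for $x\leq y$; (5) $d(\varphi\otimes\psi)=d(\varphi)\vee d(\psi)$ and $\varphi^{\downarrow x}\in\Phi_x$; (6) $(\varphi^{\downarrow y})^{\downarrow x}=\varphi^{\downarrow x}$ for $x\leq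 y\leq d(\varphi)$; (7) $(\varphi\otimes\psi)^{\downarrow d(\varphi)}=\varphi\otimes\psi^{\downarrow d(\varphi)\wedge d(\psi)}$; (8) $\varphi_1\otimes\varphi_2\leq\psi_1\otimes\psi_2$ whenever $\varphi_i\leq\psi_i$; (9) $\varphi^{\downarrow x}\leq\psi^{\downarrow x}$ whenever $\varphi\leq\psi$ and $x\leq d(\varphi)=d(\psi)$. -}

module Defs where

open import Level using (Level; _⊔_; suc)
open import Relation.Binary.Core using (Rel)
open import Relation.Binary.PropositionalEquality using (_≡_)
open import Relation.Binary.Structures using (IsPartialOrder)
open import Relation.Binary.Lattice.Structures using (IsBoundedLattice)
open import Algebra.Core using (Op₂)
open import Algebra.Structures using (IsCommutativeSemigroup)
open import Data.Product using (_×_)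

-- The partial focusing operation φ ↓ x (defined when x ≤ d φ) is rendered
-- as `proj φ x p` with p : x ≤D d φ, required to be independent of p.
record IsOVAWithoutDomainCondition
    {a b ℓ ℓD : Level} {Φ : Set a} {D : Set b}
    (_≤_ : Rel Φ ℓ) (_≤D_ : Rel D ℓD) (_∨_ _∧_ : Op₂ D) (⊤ ⊥ : D)
    (_⊗_ : Op₂ Φ) (d : Φ → D)
    (proj : (φ : Φ) (x : D) → x ≤D d φ → Φ) (e : D → Φ)
    : Set (a ⊔ b ⊔ ℓ ⊔ ℓD) where
  field
    isPartialOrder   : IsPartialOrder _≡_ _≤_
    isBoundedLattice : IsBoundedLattice _≡_ _≤D_ _∨_ _∧_ ⊤ ⊥
    proj-irrelevant  : ∀ φ x (p q : x ≤D d φ) → proj φ x p ≡ proj φ x q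
    ⊗-isCommutativeSemigroup : IsCommutativeSemigroup _≡_ _⊗_
    d-e       : ∀ x → d (e x) ≡ x
    e-⊗       : ∀ x y → (e x ⊗ e y) ≡ e (x ∨ y)
    e-neutral : ∀ x φ → d φ ≡ x → (φ ⊗ e x) ≡ φ
    e-proj    : ∀ x y (p : x ≤D d (e y)) → x ≤D y → proj (e y) x p ≡ e x
    d-⊗       : ∀ φ ψ → d (φ ⊗ ψ) ≡ (d φ ∨ d ψ)
    d-proj    : ∀ φ x (p : x ≤D d φ) → d (proj φ x p) ≡ x
    proj-trans : ∀ φ x y (q : y ≤D d φ) (r : x ≤D d (proj φ y q)) (s : x ≤D d φ) →
                 x ≤D y → proj (proj φ y q) x r ≡ proj φ x s
    combination : ∀ φ ψ (p : d φ ≤D d (φ ⊗ ψ)) (q : (d φ ∧ d ψ) ≤D d ψ) →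
                  proj (φ ⊗ ψ) (d φ) p ≡ (φ ⊗ proj ψ (d φ ∧ d ψ) q)
    ⊗-mono : ∀ {φ₁ φ₂ ψ₁ ψ₂} → φ₁ ≤ ψ₁ → φ₂ ≤ ψ₂ → (φ₁ ⊗ φ₂) ≤ (ψ₁ ⊗ ψ₂)
    proj-mono : ∀ φ ψ x (p : x ≤D d φ) (q : x ≤D d ψ) → φ ≤ ψ →
                proj φ x p ≤ proj ψ x q

record IsOrderedValuationAlgebra
    {a b ℓ ℓD : Level} {Φ : Set a} {D : Set b}
    (_≤_ : Rel Φ ℓ) (_≤D_ : Rel D ℓD) (_∨_ _∧_ : Op₂ D) (⊤ ⊥ : D)
    (_⊗_ : Op₂ Φ) (d : Φ → D)
    (proj : (φ : Φ) (x : D) → x ≤D d φ → Φ) (e : D → Φ)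
    : Set (a ⊔ b ⊔ ℓ ⊔ ℓD) where
  field
    isOVAWithoutDomainCondition :
      IsOVAWithoutDomainCondition _≤_ _≤D_ _∨_ _∧_ ⊤ ⊥ _⊗_ d proj e
    ≤-same-domain : ∀ {φ ψ} → φ ≤ ψ → d φ ≡ d ψ

≤′-rel : {a b ℓ ℓD : Level} {Φ : Set a} {D : Set b} →
         Rel Φ ℓ → Rel D ℓD → Op₂ Φ → (Φ → D) → (D → Φ) → Rel Φ (ℓ ⊔ ℓD)
≤′-rel _≤_ _≤D_ _⊗_ d e φ ψ = (d φ ≤D d ψ) × ((φ ⊗ e (d ψ)) ≤ ψ)

module Submission where

-- The axioms not mentioning the order carry over unchanged, so only three
-- facts need proof: ≤′ is a partial order, ⊗ is monotone for ≤′, and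
-- focusing is monotone for ≤′.
--
-- None of
-- them uses condition (2) of the original order, so the construction
-- `reorder` works for any structure satisfying the remaining axioms, and
-- the theorem is its instance for ordered valuation algebras.

open import Defs
open import Level using (Level; _⊔_)
open import Relation.Binary.Core using (Rel)
open import Algebra.Core using (Op₂)
open import Relation.Binary.PropositionalEquality
  using (_≡_; refl; sym; trans; cong; subst; subst₂; isEquivalence; module ≡-Reasoning)
open import Relation.Binary.Structures using (IsPartialOrder)
open import Relation.Binary.Lattice.Structures using (IsBoundedLattice)
open import Relation.Binary.Lattice.Bundles using (Lattice)
open import Algebra.Bundles using (CommutativeSemigroup)
open import Data.Product using (_,_)
import Relation.Binary.Lattice.Properties.JoinSemilattice as JoinProperties
import Relation.Binary.Lattice.Properties.MeetSemilattice as MeetProperties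
import Algebra.Properties.CommutativeSemigroup as CommutativeSemigroupProperties

module Reordering {a b ℓ ℓD : Level} {Φ : Set a} {D : Set b}
    {_≤_ : Rel Φ ℓ} {_≤D_ : Rel D ℓD} {_∨_ _∧_ : Op₂ D} {⊤ ⊥ : D}
    {_⊗_ : Op₂ Φ} {d : Φ → D}
    {proj : (φ : Φ) (x : D) → x ≤D d φ → Φ} {e : D → Φ}
    (V : IsOVAWithoutDomainCondition _≤_ _≤D_ _∨_ _∧_ ⊤ ⊥ _⊗_ d proj e) where

  open IsOVAWithoutDomainCondition V
  module Φ≤ = IsPartialOrder isPartialOrder
  open IsBoundedLattice isBoundedLattice
    using (isLattice; x∧y≤y)
    renaming (refl to ≤D-refl; trans to ≤D-trans; antisym to ≤D-antisym)

  domainLattice : Lattice b b ℓD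
  domainLattice = record { isLattice = isLattice }

  open JoinProperties (Lattice.joinSemilattice domainLattice)
    using (∨-monotonic; x≤y⇒x∨y≈y)
  open MeetProperties (Lattice.meetSemilattice domainLattice)
    using (∧-comm; y≤x⇒x∧y≈y)

  combinationSemigroup : CommutativeSemigroup a a
  combinationSemigroup = record { isCommutativeSemigroup = ⊗-isCommutativeSemigroup }

  open CommutativeSemigroup combinationSemigroup using (assoc)
  open CommutativeSemigroupProperties combinationSemigroup using (interchange)

  _≤′_ : Rel Φ (ℓ ⊔ ℓD)
  _≤′_ = ≤′-rel _≤_ _≤D_ _⊗_ d e

  ∧-of-≤ : ∀ {x y} → x ≤D y → (x ∧ y) ≡ x
  ∧-of-≤ {x} {y} x≤y = trans (∧-comm x y) (y≤x⇒x∧y≈y x≤y)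

  proj-cong : ∀ {φ ψ x} → φ ≡ ψ → (p : x ≤D d φ) (q : x ≤D d ψ) →
              proj φ x p ≡ proj ψ x q
  proj-cong {φ} {x = x} refl p q = proj-irrelevant φ x p q

  d-extend : ∀ φ {x} → d φ ≤D x → d (φ ⊗ e x) ≡ x
  d-extend φ {x} dφ≤x = begin
    d (φ ⊗ e x)     ≡⟨ d-⊗ φ (e x) ⟩
    d φ ∨ d (e x)   ≡⟨ cong (d φ ∨_) (d-e x) ⟩
    d φ ∨ x         ≡⟨ x≤y⇒x∨y≈y dφ≤x ⟩
    x               ∎
    where open ≡-Reasoning

  extend-extend : ∀ φ {x y} → x ≤D y → ((φ ⊗ e x) ⊗ e y) ≡ (φ ⊗ e y)
  extend-extend φ {x} {y} x≤y = begin
    (φ ⊗ e x) ⊗ e y ≡⟨ assoc φ (e x) (e y) ⟩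
    φ ⊗ (e x ⊗ e y) ≡⟨ cong (φ ⊗_) (e-⊗ x y) ⟩
    φ ⊗ e (x ∨ y)   ≡⟨ cong (λ z → φ ⊗ e z) (x≤y⇒x∨y≈y x≤y) ⟩
    φ ⊗ e y         ∎
    where open ≡-Reasoning

  -- Focusing a vacuous extension back to the original domain recovers φ
  -- (by the combination axiom, this is φ ⊗ e_{d φ} = φ).
  focus-extend : ∀ φ {x} → d φ ≤D x → (p : d φ ≤D d (φ ⊗ e x)) →
                 proj (φ ⊗ e x) (d φ) p ≡ φ
  focus-extend φ {x} dφ≤x p = begin
    proj (φ ⊗ e x) (d φ) p                ≡⟨ combination φ (e x) p meet≤ ⟩
    φ ⊗ proj (e x) (d φ ∧ d (e x)) meet≤  ≡⟨ cong (φ ⊗_) (e-proj _ x meet≤ meet≤x) ⟩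
    φ ⊗ e (d φ ∧ d (e x))                 ≡⟨ cong (λ z → φ ⊗ e z) meet≡ ⟩
    φ ⊗ e (d φ)                           ≡⟨ e-neutral (d φ) φ refl ⟩
    φ                                     ∎
    where
    open ≡-Reasoning
    meet≤ : (d φ ∧ d (e x)) ≤D d (e x)
    meet≤ = x∧y≤y (d φ) (d (e x))
    meet≤x : (d φ ∧ d (e x)) ≤D x
    meet≤x = subst ((d φ ∧ d (e x)) ≤D_) (d-e x) meet≤
    meet≡ : (d φ ∧ d (e x)) ≡ d φ
    meet≡ = ∧-of-≤ (subst (d φ ≤D_) (sym (d-e x)) dφ≤x)

  focus-below-extend : ∀ φ {x y} → d φ ≤D x → (p : y ≤D d φ) (q : y ≤D d (φ ⊗ e x)) →
                       proj (φ ⊗ e x) y q ≡ proj φ y p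
  focus-below-extend φ {x} {y} dφ≤x p q = begin
    proj (φ ⊗ e x) y q                         ≡⟨ sym (proj-trans _ y (d φ) dφ≤ q′ q p) ⟩
    proj (proj (φ ⊗ e x) (d φ) dφ≤) y q′       ≡⟨ proj-cong (focus-extend φ dφ≤x dφ≤) q′ p ⟩
    proj φ y p                                 ∎
    where
    open ≡-Reasoning
    dφ≤ : d φ ≤D d (φ ⊗ e x)
    dφ≤ = subst (d φ ≤D_) (sym (d-extend φ dφ≤x)) dφ≤x
    q′ : y ≤D d (proj (φ ⊗ e x) (d φ) dφ≤)
    q′ = subst (y ≤D_) (sym (d-proj _ (d φ) dφ≤)) p

  ≤′⇒≤ : ∀ {φ ψ} → d φ ≡ d ψ → φ ≤′ ψ → φ ≤ ψ
  ≤′⇒≤ {φ} {ψ} dφ≡dψ (_ , φe≤ψ) = subst (_≤ ψ) (e-neutral (d ψ) φ dφ≡dψ) φe≤ψ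

  ≤⇒≤′ : ∀ {φ ψ} → d φ ≡ d ψ → φ ≤ ψ → φ ≤′ ψ
  ≤⇒≤′ {φ} {ψ} dφ≡dψ φ≤ψ =
    subst (_≤D d ψ) (sym dφ≡dψ) ≤D-refl ,
    subst (_≤ ψ) (sym (e-neutral (d ψ) φ dφ≡dψ)) φ≤ψ

  ≤′-reflexive : ∀ {φ ψ} → φ ≡ ψ → φ ≤′ ψ
  ≤′-reflexive refl = ≤⇒≤′ refl (Φ≤.reflexive refl)

  -- Transitivity: extend φ ⊗ e_{dψ} ≤ ψ further to the domain of χ.
  ≤′-trans : ∀ {φ ψ χ} → φ ≤′ ψ → ψ ≤′ χ → φ ≤′ χ
  ≤′-trans {φ} {ψ} {χ} (dφ≤dψ , φe≤ψ) (dψ≤dχ , ψe≤χ) =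
    ≤D-trans dφ≤dψ dψ≤dχ ,
    subst (_≤ χ) (extend-extend φ dψ≤dχ)
      (Φ≤.trans (⊗-mono φe≤ψ (Φ≤.reflexive refl)) ψe≤χ)

  -- Antisymmetry: mutual ≤′ forces equal domains, where ≤′ is just ≤.
  ≤′-antisym : ∀ {φ ψ} → φ ≤′ ψ → ψ ≤′ φ → φ ≡ ψ
  ≤′-antisym φ≤′ψ@(dφ≤dψ , _) ψ≤′φ@(dψ≤dφ , _) =
    Φ≤.antisym (≤′⇒≤ dφ≡dψ φ≤′ψ) (≤′⇒≤ (sym dφ≡dψ) ψ≤′φ)
    where dφ≡dψ = ≤D-antisym dφ≤dψ dψ≤dφ

  ≤′-isPartialOrder : IsPartialOrder _≡_ _≤′_
  ≤′-isPartialOrder = record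
    { isPreorder = record
      { isEquivalence = isEquivalence
      ; reflexive     = ≤′-reflexive
      ; trans         = ≤′-trans
      }
    ; antisym = ≤′-antisym
    }

  -- Monotonicity of ⊗: the extension of φ₁ ⊗ φ₂ to d(ψ₁ ⊗ ψ₂) is the
  -- combination of the extensions of φ₁ and φ₂ to d ψ₁ and d ψ₂.
  ≤′-⊗-mono : ∀ {φ₁ φ₂ ψ₁ ψ₂} → φ₁ ≤′ ψ₁ → φ₂ ≤′ ψ₂ → (φ₁ ⊗ φ₂) ≤′ (ψ₁ ⊗ ψ₂)
  ≤′-⊗-mono {φ₁} {φ₂} {ψ₁} {ψ₂} (d₁≤ , φe₁≤ψ₁) (d₂≤ , φe₂≤ψ₂) =
    subst₂ _≤D_ (sym (d-⊗ φ₁ φ₂)) (sym (d-⊗ ψ₁ ψ₂)) (∨-monotonic d₁≤ d₂≤) ,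
    subst (_≤ (ψ₁ ⊗ ψ₂)) (sym extension-splits) (⊗-mono φe₁≤ψ₁ φe₂≤ψ₂)
    where
    extension-splits : ((φ₁ ⊗ φ₂) ⊗ e (d (ψ₁ ⊗ ψ₂))) ≡ ((φ₁ ⊗ e (d ψ₁)) ⊗ (φ₂ ⊗ e (d ψ₂)))
    extension-splits = begin
      (φ₁ ⊗ φ₂) ⊗ e (d (ψ₁ ⊗ ψ₂))           ≡⟨ cong (λ z → (φ₁ ⊗ φ₂) ⊗ e z) (d-⊗ ψ₁ ψ₂) ⟩
      (φ₁ ⊗ φ₂) ⊗ e (d ψ₁ ∨ d ψ₂)           ≡⟨ cong ((φ₁ ⊗ φ₂) ⊗_) (sym (e-⊗ (d ψ₁) (d ψ₂))) ⟩
      (φ₁ ⊗ φ₂) ⊗ (e (d ψ₁) ⊗ e (d ψ₂))     ≡⟨ interchange φ₁ φ₂ (e (d ψ₁)) (e (d ψ₂)) ⟩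
      (φ₁ ⊗ e (d ψ₁)) ⊗ (φ₂ ⊗ e (d ψ₂))     ∎
      where open ≡-Reasoning

  -- Monotonicity of focusing: focusing the extension φ ⊗ e_{dψ} to x gives
  -- φ↓x, so the original axiom (9) applied to φ ⊗ e_{dψ} ≤ ψ suffices;
  -- both focused valuations have domain x, where ≤′ and ≤ agree.
  ≤′-proj-mono : ∀ φ ψ x (p : x ≤D d φ) (q : x ≤D d ψ) → φ ≤′ ψ →
                 proj φ x p ≤′ proj ψ x q
  ≤′-proj-mono φ ψ x p q (dφ≤dψ , φe≤ψ) =
    ≤⇒≤′ (trans (d-proj φ x p) (sym (d-proj ψ x q)))
      (subst (_≤ proj ψ x q) (focus-below-extend φ dφ≤dψ p p′)
        (proj-mono (φ ⊗ e (d ψ)) ψ x p′ q φe≤ψ))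
    where
    p′ : x ≤D d (φ ⊗ e (d ψ))
    p′ = subst (x ≤D_) (sym (d-extend φ dφ≤dψ)) q

  reorder : IsOVAWithoutDomainCondition _≤′_ _≤D_ _∨_ _∧_ ⊤ ⊥ _⊗_ d proj e
  reorder = record
    { isPartialOrder           = ≤′-isPartialOrder
    ; isBoundedLattice         = isBoundedLattice
    ; proj-irrelevant          = proj-irrelevant
    ; ⊗-isCommutativeSemigroup = ⊗-isCommutativeSemigroup
    ; d-e                      = d-e
    ; e-⊗                      = e-⊗
    ; e-neutral                = e-neutral
    ; e-proj                   = e-proj
    ; d-⊗                      = d-⊗
    ; d-proj                   = d-proj
    ; proj-trans               = proj-trans
    ; combination              = combination
    ; ⊗-mono                   = ≤′-⊗-mono
    ; proj-mono                = ≤′-proj-mono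
    }

mainTheorem13 : ∀ {a b ℓ ℓD : Level} {Φ : Set a} {D : Set b}
    {_≤_ : Rel Φ ℓ} {_≤D_ : Rel D ℓD} {_∨_ _∧_ : Op₂ D} {⊤ ⊥ : D}
    {_⊗_ : Op₂ Φ} {d : Φ → D}
    {proj : (φ : Φ) (x : D) → x ≤D d φ → Φ} {e : D → Φ} →
    IsOrderedValuationAlgebra _≤_ _≤D_ _∨_ _∧_ ⊤ ⊥ _⊗_ d proj e →
    IsOVAWithoutDomainCondition (≤′-rel _≤_ _≤D_ _⊗_ d e) _≤D_ _∨_ _∧_ ⊤ ⊥ _⊗_ d proj e
mainTheorem13 O = Reordering.reorder (IsOrderedValuationAlgebra.isOVAWithoutDomainCondition O)
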